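{- (1) For every tree $\mathfrak{T}$ and every stem $S$ of $\mathfrak{T}$, if $S$ is branching$_1$ then $S$ is branching$_2$. (2) The converse fails: there exist a tree $\mathfrak{T}$ and a stem $S$ of $\mathfrak{T}$ such that $S$ is branching$_2$ but not branching$_1$.
   Context: A forest is a strict partial order $(F;<)$ such that for every $x$ the set $\{y:y<x\}$ is linearly ordered; a tree is a forest that is downward-connected: for all $x,y$ there is $z$ with $z\leqslant x$ and $z\leqslant y$. Trees are not assumed well-founded or rooted. A path is a maximal linearly ordered set of nodes. A stem is a nonempty linearly ordered set of nodes that is downward-closed and bounded above. For a stem $S$ let $T^{>S}=\{x:s<x\text{ for all } s\in S\}$ and $\mathcal{P}_S$ the set of paths containing $S$. Paths $A_1,A_2\in\mathcal{P}_S$ are undivided at $S$ if $A_1\cap A_2\cap T^{>S}\neq\emptyset$ (an equivalence relation on $\mathcal{P}_S$). A $<$-component of a forest $(F;<)$ is a nonempty $C\subseteq F$ such that (i) if $t\in C$, $t'\leqslant t$ and $t'\leqslant u$ then $u\in C$, and (ii) $C$ is minimal under inclusion with (i). A stem $S$ is branching$_1$ if undividedness at $S$ has more than one equivalence class (equivalently, the forest $T^{>S}$ has more than one $<$-component); $S$ is branching$_2$ if every node of $T^{>S}$ is incomparable with some node of $T^{>S}$. -}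

module Defs where

open import Level using (0ℓ)
open import Data.Product using (Σ; ∃; ∃-syntax; _×_; _,_)
open import Data.Sum using (_⊎_)
open import Relation.Nullary using (¬_)
open import Relation.Unary using (Pred; _∈_; _⊆_)
open import Relation.Binary using (Rel; IsStrictPartialOrder)
open import Relation.Binary.PropositionalEquality using (_≡_)

LinearlyOrdered : {A : Set} → Rel A 0ℓ → Pred A 0ℓ → Set
LinearlyOrdered _<_ X = ∀ {a b} → a ∈ X → b ∈ X → (a < b) ⊎ (a ≡ b) ⊎ (b < a)

Le : {A : Set} → Rel A 0ℓ → Rel A 0ℓ
Le _<_ x y = (x < y) ⊎ (x ≡ y)

-- A tree: strict partial order, predecessors linearly ordered, downward connected.
-- Not assumed well-founded or rooted.
record Tree : Set₁ where
  field
    Node  : Set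
    _<_   : Rel Node 0ℓ
    isStrictPartialOrder : IsStrictPartialOrder _≡_ _<_
    predLinear : ∀ x → LinearlyOrdered _<_ (λ y → y < x)
    downConnected : ∀ x y → ∃[ z ] (Le _<_ z x × Le _<_ z y)

  _≤_ : Rel Node 0ℓ
  _≤_ = Le _<_

  Linear : Pred Node 0ℓ → Set
  Linear = LinearlyOrdered _<_

  IsPath : Pred Node 0ℓ → Set₁
  IsPath A = Linear A × (∀ (B : Pred Node 0ℓ) → Linear B → A ⊆ B → B ⊆ A)

  IsStem : Pred Node 0ℓ → Set
  IsStem S = (∃[ s ] s ∈ S)
           × Linear S
           × (∀ {s t} → s ∈ S → t < s → t ∈ S)
           × (∃[ b ] (∀ {s} → s ∈ S → s ≤ b))

  Above : Pred Node 0ℓ → Pred Node 0ℓ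
  Above S x = ∀ {s} → s ∈ S → s < x

  PathThrough : Pred Node 0ℓ → Pred Node 0ℓ → Set₁
  PathThrough S A = IsPath A × S ⊆ A

  Undivided : Pred Node 0ℓ → Pred Node 0ℓ → Pred Node 0ℓ → Set
  Undivided S A₁ A₂ = ∃[ x ] (x ∈ A₁ × x ∈ A₂ × x ∈ Above S)

  Incomparable : Node → Node → Set
  Incomparable x y = ¬ (x ≤ y) × ¬ (y ≤ x)

  -- branching₁: undividedness at S has more than one equivalence class
  Branching₁ : Pred Node 0ℓ → Set₁
  Branching₁ S = Σ (Pred Node 0ℓ) λ A₁ → Σ (Pred Node 0ℓ) λ A₂ →
                   PathThrough S A₁ × PathThrough S A₂ × ¬ Undivided S A₁ A₂

  Branching₂ : Pred Node 0ℓ → Set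
  Branching₂ S = ∀ x → x ∈ Above S → ∃[ y ] (y ∈ Above S × Incomparable x y)

{-# OPTIONS --safe #-}
-- (1) If paths A₁, A₂ through S share no node above S, a node x above S cannot lie on
-- both; classically, a path that misses x contains a node incomparable with x, and such
-- a node is again above S because it is comparable with S ⊆ A while not below x.
-- (2) Above a root r take a descending spine s₀ ⊐ s₁ ⊐ s₂ ⊐ ⋯ and leaves ℓₙ with
-- sₘ ⊏ ℓₙ exactly when n ≤ m. Every path meets the spine, and then contains a whole
-- tail of it, so any two paths meet above r; yet sₙ and ℓₙ are incomparable with ℓₙ₊₁.
module Submission where

open import Defs
open import Level using (0ℓ; lift; lower)
open import Axiom.ExcludedMiddle using (ExcludedMiddle)
open import Data.Product using (Σ; _×_; _,_; ∃-syntax)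
open import Data.Sum using (_⊎_; inj₁; inj₂)
open import Data.Empty using (⊥-elim)
open import Data.Nat using (ℕ; zero; suc; _+_; s≤s)
import Data.Nat as ℕ
open import Data.Nat.Properties
  using (<-trans; ≤-trans; <-irrefl; <⇒≤; ≤-refl; m≤m+n; m≤n+m; n<1+n; <⇒≢; <-cmp; <⇒≱)
open import Relation.Nullary using (¬_; Dec; yes; no)
open import Relation.Nullary.Decidable using (map′)
open import Relation.Unary using (Pred; _∈_; _∉_; _⊆_)
open import Relation.Binary using (IsStrictPartialOrder; tri<; tri≈; tri>)
open import Relation.Binary.PropositionalEquality as ≡ using (_≡_; _≢_; refl)

decide : ExcludedMiddle (Level.suc 0ℓ) → (P : Set) → Dec P
decide em P = map′ lower lift em

module TreeProperties (T : Tree) where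
  open Tree T
  open IsStrictPartialOrder isStrictPartialOrder using (trans)

  Comparable : Node → Node → Set
  Comparable a b = (a < b) ⊎ (a ≡ b) ⊎ (b < a)

  comparable-sym : ∀ {a b} → Comparable a b → Comparable b a
  comparable-sym (inj₁ a<b)         = inj₂ (inj₂ a<b)
  comparable-sym (inj₂ (inj₁ refl)) = inj₂ (inj₁ refl)
  comparable-sym (inj₂ (inj₂ b<a))  = inj₁ b<a

  comparable-with-path⇒∈ : ∀ {A} → IsPath A → ∀ x →
                           (∀ {a} → a ∈ A → Comparable a x) → x ∈ A
  comparable-with-path⇒∈ {A} (linear , maximal) x comparable =
    maximal A∪x linear-A∪x inj₁ (inj₂ refl)
    where
    A∪x : Pred Node 0ℓ
    A∪x z = z ∈ A ⊎ z ≡ x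

    linear-A∪x : Linear A∪x
    linear-A∪x (inj₁ a)    (inj₁ b)    = linear a b
    linear-A∪x (inj₁ a)    (inj₂ refl) = comparable a
    linear-A∪x (inj₂ refl) (inj₁ b)    = comparable-sym (comparable b)
    linear-A∪x (inj₂ refl) (inj₂ refl) = inj₂ (inj₁ refl)

  path-downClosed : ∀ {A x y} → IsPath A → x ∈ A → y < x → y ∈ A
  path-downClosed {A} {x} {y} path@(linear , _) x∈A y<x =
    comparable-with-path⇒∈ path y comparable
    where
    comparable : ∀ {a} → a ∈ A → Comparable a y
    comparable a∈A with linear a∈A x∈A
    ... | inj₁ a<x         = predLinear x a<x y<x
    ... | inj₂ (inj₁ refl) = inj₂ (inj₂ y<x)
    ... | inj₂ (inj₂ x<a)  = inj₂ (inj₂ (trans y<x x<a))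

  incomparable-with-path-through-above :
    ∀ {S A x y} → S ⊆ A → Linear A → x ∈ Above S → y ∈ A →
    Incomparable x y → y ∈ Above S
  incomparable-with-path-through-above S⊆A linear x>S y∈A (_ , y≰x) {s} s∈S
    with linear (S⊆A s∈S) y∈A
  ... | inj₁ s<y         = s<y
  ... | inj₂ (inj₁ refl) = ⊥-elim (y≰x (inj₁ (x>S s∈S)))
  ... | inj₂ (inj₂ y<s)  = ⊥-elim (y≰x (inj₁ (trans y<s (x>S s∈S))))

  module _ (em : ExcludedMiddle (Level.suc 0ℓ)) where

    ¬incomparable⇒comparable : ∀ {x y} → ¬ Incomparable x y → Comparable y x
    ¬incomparable⇒comparable {x} {y} ¬incomparable
      with decide em (x ≤ y) | decide em (y ≤ x)
    ... | yes (inj₁ x<y)  | _               = inj₂ (inj₂ x<y)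
    ... | yes (inj₂ refl) | _               = inj₂ (inj₁ refl)
    ... | no _            | yes (inj₁ y<x)  = inj₁ y<x
    ... | no _            | yes (inj₂ refl) = inj₂ (inj₁ refl)
    ... | no x≰y          | no y≰x          = ⊥-elim (¬incomparable (x≰y , y≰x))

    ∈path⊎incomparable-above : ∀ {S A x} → PathThrough S A → x ∈ Above S →
                               x ∈ A ⊎ ∃[ y ] (y ∈ Above S × Incomparable x y)
    ∈path⊎incomparable-above {S} {A} {x} (path@(linear , _) , S⊆A) x>S
      with decide em (∃[ y ] (y ∈ A × Incomparable x y))
    ... | yes (y , y∈A , x#y) =
      inj₂ (y , incomparable-with-path-through-above S⊆A linear x>S y∈A x#y , x#y)
    ... | no none = inj₁ (comparable-with-path⇒∈ path x λ {a} a∈A →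
                      ¬incomparable⇒comparable λ x#a → none (a , a∈A , x#a))

    branching₁⇒branching₂ : ∀ {S} → Branching₁ S → Branching₂ S
    branching₁⇒branching₂ (A₁ , A₂ , through₁ , through₂ , divided) x x>S
      with ∈path⊎incomparable-above through₁ x>S | ∈path⊎incomparable-above through₂ x>S
    ... | inj₂ found | _         = found
    ... | inj₁ _     | inj₂ found = found
    ... | inj₁ x∈A₁  | inj₁ x∈A₂  = ⊥-elim (divided (x , x∈A₁ , x∈A₂ , x>S))

module Comb where

  data Node : Set where
    root  : Node
    spine : ℕ → Node
    leaf  : ℕ → Node

  infix 4 _⊏_
  data _⊏_ : Node → Node → Set where
    root⊏spine  : ∀ {n} → root ⊏ spine n
    root⊏leaf   : ∀ {n} → root ⊏ leaf n
    spine⊏spine : ∀ {m n} → n ℕ.< m → spine m ⊏ spine n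
    spine⊏leaf  : ∀ {m n} → n ℕ.≤ m → spine m ⊏ leaf n

  ⊏-irrefl : ∀ {x y} → x ≡ y → ¬ x ⊏ y
  ⊏-irrefl refl (spine⊏spine n<n) = <-irrefl refl n<n

  ⊏-trans : ∀ {x y z} → x ⊏ y → y ⊏ z → x ⊏ z
  ⊏-trans root⊏spine      (spine⊏spine _) = root⊏spine
  ⊏-trans root⊏spine      (spine⊏leaf _)  = root⊏leaf
  ⊏-trans (spine⊏spine p) (spine⊏spine q) = spine⊏spine (<-trans q p)
  ⊏-trans (spine⊏spine p) (spine⊏leaf q)  = spine⊏leaf (≤-trans q (<⇒≤ p))

  ⊏-isStrictPartialOrder : IsStrictPartialOrder _≡_ _⊏_
  ⊏-isStrictPartialOrder = record
    { isEquivalence = ≡.isEquivalence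
    ; irrefl        = ⊏-irrefl
    ; trans         = ⊏-trans
    ; <-resp-≈      = (λ { refl p → p }) , (λ { refl p → p })
    }

  ⊏-predLinear : ∀ x → LinearlyOrdered _⊏_ (λ y → y ⊏ x)
  ⊏-predLinear _ root⊏spine      root⊏spine      = inj₂ (inj₁ refl)
  ⊏-predLinear _ root⊏spine      (spine⊏spine _) = inj₁ root⊏spine
  ⊏-predLinear _ (spine⊏spine _) root⊏spine      = inj₂ (inj₂ root⊏spine)
  ⊏-predLinear _ root⊏leaf       root⊏leaf       = inj₂ (inj₁ refl)
  ⊏-predLinear _ root⊏leaf       (spine⊏leaf _)  = inj₁ root⊏spine
  ⊏-predLinear _ (spine⊏leaf _)  root⊏leaf       = inj₂ (inj₂ root⊏spine)
  ⊏-predLinear _ {spine m} {spine n} _ _ with <-cmp m n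
  ... | tri< m<n _ _  = inj₂ (inj₂ (spine⊏spine m<n))
  ... | tri≈ _ refl _ = inj₂ (inj₁ refl)
  ... | tri> _ _ n<m  = inj₁ (spine⊏spine n<m)

  root≤ : ∀ x → Le _⊏_ root x
  root≤ root      = inj₂ refl
  root≤ (spine _) = inj₁ root⊏spine
  root≤ (leaf _)  = inj₁ root⊏leaf

  comb : Tree
  comb = record
    { Node                 = Node
    ; _<_                  = _⊏_
    ; isStrictPartialOrder = ⊏-isStrictPartialOrder
    ; predLinear           = ⊏-predLinear
    ; downConnected        = λ x y → root , root≤ x , root≤ y
    }

  open Tree comb using (IsStem; IsPath; Incomparable; Branching₁; Branching₂)
  open TreeProperties comb using (Comparable; comparable-with-path⇒∈; path-downClosed)

  OnlyRoot : Pred Node 0ℓ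
  OnlyRoot x = x ≡ root

  OnlyRoot-isStem : IsStem OnlyRoot
  OnlyRoot-isStem =
      (root , refl)
    , (λ { refl refl → inj₂ (inj₁ refl) })
    , (λ { refl () })
    , (root , λ { refl → inj₂ refl })

  spine-incomparable-leaf : ∀ {m n} → m ℕ.< n → Incomparable (spine m) (leaf n)
  spine-incomparable-leaf m<n =
      (λ { (inj₁ (spine⊏leaf n≤m)) → <⇒≱ m<n n≤m ; (inj₂ ()) })
    , (λ { (inj₁ ()) ; (inj₂ ()) })

  leaf-incomparable-leaf : ∀ {m n} → m ≢ n → Incomparable (leaf m) (leaf n)
  leaf-incomparable-leaf m≢n =
      (λ { (inj₁ ()) ; (inj₂ refl) → m≢n refl })
    , (λ { (inj₁ ()) ; (inj₂ refl) → m≢n refl })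

  OnlyRoot-branching₂ : Branching₂ OnlyRoot
  OnlyRoot-branching₂ root      root>root = ⊥-elim (⊏-irrefl refl (root>root refl))
  OnlyRoot-branching₂ (spine n) _ =
    leaf (suc n) , (λ { refl → root⊏leaf }) , spine-incomparable-leaf (n<1+n n)
  OnlyRoot-branching₂ (leaf n)  _ =
    leaf (suc n) , (λ { refl → root⊏leaf }) , leaf-incomparable-leaf (<⇒≢ (n<1+n n))

  -- A path without spine nodes has no leaves either, so spine 0 is comparable with all of it.
  path-meets-spine : ∀ {A} → IsPath A → ¬ (∀ n → spine n ∉ A)
  path-meets-spine {A} path no-spine =
    no-spine 0 (comparable-with-path⇒∈ path (spine 0) comparable)
    where
    comparable : ∀ {a} → a ∈ A → Comparable a (spine 0)
    comparable {root}          _      = inj₁ root⊏spine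
    comparable {spine zero}    _      = inj₂ (inj₁ refl)
    comparable {spine (suc _)} _      = inj₁ (spine⊏spine (s≤s ℕ.z≤n))
    comparable {leaf n}        leaf∈A =
      ⊥-elim (no-spine n (path-downClosed path leaf∈A (spine⊏leaf ≤-refl)))

  OnlyRoot-¬branching₁ : ¬ Branching₁ OnlyRoot
  OnlyRoot-¬branching₁ (A₁ , A₂ , (path₁ , _) , (path₂ , _) , divided) =
    path-meets-spine path₁ λ m m∈A₁ → path-meets-spine path₂ λ n n∈A₂ →
      divided ( spine (suc (m + n))
              , path-downClosed path₁ m∈A₁ (spine⊏spine (s≤s (m≤m+n m n)))
              , path-downClosed path₂ n∈A₂ (spine⊏spine (s≤s (m≤n+m n m)))
              , λ { refl → root⊏spine } )

proposition3p8 :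
    (ExcludedMiddle (Level.suc 0ℓ) →
      (T : Tree) (S : Pred (Tree.Node T) 0ℓ) →
      Tree.IsStem T S → Tree.Branching₁ T S → Tree.Branching₂ T S)
    ×
    (Σ Tree λ T → Σ (Pred (Tree.Node T) 0ℓ) λ S →
      Tree.IsStem T S × Tree.Branching₂ T S × ¬ Tree.Branching₁ T S)
proposition3p8 =
    (λ em T _ _ → TreeProperties.branching₁⇒branching₂ T em)
  , (comb , OnlyRoot , OnlyRoot-isStem , OnlyRoot-branching₂ , OnlyRoot-¬branching₁)
  where open Comb
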